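{- Let $\Delta=q^{s-1}$, $m\in\mathbb{Z}$, and let $\mathcal{P}$ be a vector space partition of $\mathbb{F}_q^v$ of hole-type $(t,s,c)$. Then $\tau_q(c,\Delta,m)\cdot \frac{q^{v-2}}{\Delta^2}-m(m-1)\ge 0$ and $\tau_q(c,\Delta,m)\ge 0$, where $\tau_q(c,\Delta,m)=m(m-1)\Delta^2q^2-c(2m-1)(q-1)\Delta q+c(q-1)\big(c(q-1)+1\big)$. If $c>0$, then $\tau_q(c,\Delta,m)=0$ if and only if $m=1$ and $c=\frac{q^s-1}{q-1}$.
   Context: $q$ is a prime power. A vector space partition of $\mathbb{F}_q^v$ is a collection of nonzero subspaces such that every nonzero vector lies in exactly one member. It has hole-type $(t,s,m_1)$ if it has exactly $m_1$ members of dimension $1$ (holes), $2\le s\le t<v$, every other member (non-hole) has dimension between $s$ and $t$, and there is at least one non-hole. -}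

module Defs where

open import Data.Nat using (ℕ; zero; suc; _≤_; _<_; _∸_; _^_)
import Data.Nat as ℕ
open import Data.Fin using (Fin; zero; suc)
open import Data.Product using (Σ; ∃; _×_; _,_)
open import Relation.Binary.PropositionalEquality using (_≡_; _≢_)
open import Relation.Nullary using (¬_; yes; no)
open import Algebra.Structures using (IsCommutativeRing)
open import Data.Integer using (ℤ; +_; 1ℤ)
import Data.Integer as ℤ

-- A finite field with exactly q elements, realised on the carrier Fin q
-- (every finite field of order q is isomorphic to one of this form).
record FiniteField (q : ℕ) : Set where
  infixl 6 _+_
  infixl 7 _*_
  field
    _+_ _*_ : Fin q → Fin q → Fin q
    -_ : Fin q → Fin q
    0# 1# : Fin q
    isCommutativeRing : IsCommutativeRing _≡_ _+_ _*_ -_ 0# 1#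
    0≢1 : 0# ≢ 1#
    inverse : ∀ x → x ≢ 0# → ∃ λ y → x * y ≡ 1#

module _ {q : ℕ} (K : FiniteField q) where
  open FiniteField K

  Vect : ℕ → Set
  Vect v = Fin v → Fin q

  sumF : ∀ {n} → (Fin n → Fin q) → Fin q
  sumF {zero} f = 0#
  sumF {suc n} f = f zero + sumF (λ i → f (suc i))

  InSpan : ∀ {v d} → (Fin d → Vect v) → Vect v → Set
  InSpan {v} {d} b x = ∃ λ (a : Fin d → Fin q) → ∀ (j : Fin v) → x j ≡ sumF (λ i → a i * b i j)

  LinearlyIndependent : ∀ {v d} → (Fin d → Vect v) → Set
  LinearlyIndependent {v} {d} b =
    ∀ (a : Fin d → Fin q) → (∀ (j : Fin v) → sumF (λ i → a i * b i j) ≡ 0#) → ∀ i → a i ≡ 0#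

  NonZeroVect : ∀ {v} → Vect v → Set
  NonZeroVect {v} x = ¬ (∀ (j : Fin v) → x j ≡ 0#)

  record Subspace (v : ℕ) : Set where
    field
      dim : ℕ
      basis : Fin dim → Vect v
      independent : LinearlyIndependent basis
      nonzero : 1 ≤ dim

  record VSP (v : ℕ) : Set where
    field
      N : ℕ
      member : Fin N → Subspace v
      partition : ∀ (x : Vect v) → NonZeroVect x →
        Σ (Fin N) λ i → InSpan (Subspace.basis (member i)) x ×
          (∀ (j : Fin N) → InSpan (Subspace.basis (member j)) x → j ≡ i)

    dimOf : Fin N → ℕ
    dimOf i = Subspace.dim (member i)

  countOnes : ∀ {n} → (Fin n → ℕ) → ℕ
  countOnes {zero} f = 0
  countOnes {suc n} f with f zero ℕ.≟ 1
  ... | yes _ = suc (countOnes (λ i → f (suc i)))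
  ... | no _ = countOnes (λ i → f (suc i))

  record HoleType {v : ℕ} (P : VSP v) (t s m₁ : ℕ) : Set where
    open VSP P
    field
      2≤s : 2 ≤ s
      s≤t : s ≤ t
      t<v : t < v
      holes : countOnes dimOf ≡ m₁
      nonHoleDims : ∀ i → dimOf i ≢ 1 → s ≤ dimOf i × dimOf i ≤ t
      someNonHole : ∃ λ i → dimOf i ≢ 1

τ : ℕ → ℕ → ℕ → ℤ → ℤ
τ q c Δ m =
  (m ℤ.* (m ℤ.- 1ℤ) ℤ.* (+ Δ) ℤ.* (+ Δ) ℤ.* (+ q) ℤ.* (+ q))
  ℤ.- ((+ c) ℤ.* ((+ 2) ℤ.* m ℤ.- 1ℤ) ℤ.* ((+ q) ℤ.- 1ℤ) ℤ.* (+ Δ) ℤ.* (+ q))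
  ℤ.+ ((+ c) ℤ.* ((+ q) ℤ.- 1ℤ) ℤ.* ((+ c) ℤ.* ((+ q) ℤ.- 1ℤ) ℤ.+ 1ℤ))

-- For a vector u of F_q^v let h(u) be the number of holes not contained in the hyperplane u^⊥.
-- Counting the vectors off u^⊥ member by member gives q^(v-1) = h(u) + Δ·(contribution of the
-- non-holes), since every non-hole has dimension at least s; hence Δ divides h(u) and
-- (h(u) - mΔ)(h(u) - mΔ + Δ) ≥ 0. Summing over all u, with Σ h = c(q^v - q^(v-1)) and Σ h²
-- obtained from the number of u orthogonal to two distinct holes, yields τ·q^(v-2), while the
-- term at u = 0 alone is m(m-1)Δ². The equality case comes from evaluating τ at m = 0 and m = 1.
module Submission where

open import Defs
open import Level using (Level)
open import Data.Nat as ℕ using (ℕ; zero; suc)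
import Data.Nat.Properties as ℕP
open import Data.Integer as ℤ using (ℤ; +_; 0ℤ; 1ℤ)
import Data.Integer.Properties as ℤP
open import Data.Integer.Tactic.RingSolver using (solve-∀)
open import Data.Fin using (Fin; zero; suc)
import Data.Fin.Properties as FinP
open import Data.Vec using (Vec; []; _∷_; replicate; zipWith; map; lookup; tabulate)
import Data.Vec.Properties as VecP
open import Data.Product using (∃; _×_; _,_; proj₁; proj₂)
open import Data.Sum using (_⊎_; inj₁; inj₂)
open import Data.Empty using (⊥-elim)
open import Function using (_∘_; _⇔_; mk⇔; Equivalence)
open import Relation.Binary.PropositionalEquality
open import Relation.Nullary using (Dec; yes; no; ¬_)
open import Algebra.Bundles using (CommutativeRing)
open import Algebra.Structures using (IsCommutativeRing)
import Algebra.Properties.Ring as RingProperties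
import Algebra.Properties.CommutativeSemigroup as CommutativeSemigroupProperties
open import Algebra.Properties.Semiring.Sum ℤP.+-*-semiring
  using (sum; sum-syntax; sum-cong-≗; ∑-distrib-+; ∑-comm; *-distribˡ-sum; *-distribʳ-sum)

module Indicator where
  open import Data.Integer using (_*_)

  private variable
    a b c : Level
    A : Set a
    B : Set b
    C : Set c

  𝟙 : Dec A → ℤ
  𝟙 (yes _) = 1ℤ
  𝟙 (no _) = 0ℤ

  𝟙-yes : (d : Dec A) → A → 𝟙 d ≡ 1ℤ
  𝟙-yes (yes _) _ = refl
  𝟙-yes (no ¬a) a = ⊥-elim (¬a a)

  𝟙-no : (d : Dec A) → ¬ A → 𝟙 d ≡ 0ℤ
  𝟙-no (yes a) ¬a = ⊥-elim (¬a a)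
  𝟙-no (no _) _ = refl

  𝟙-idem : (d : Dec A) → 𝟙 d * 𝟙 d ≡ 𝟙 d
  𝟙-idem (yes _) = refl
  𝟙-idem (no _) = refl

  𝟙-cong : (d : Dec A) (e : Dec B) → (A → B) → (B → A) → 𝟙 d ≡ 𝟙 e
  𝟙-cong (yes _) (yes _) f g = refl
  𝟙-cong (yes a) (no ¬b) f g = ⊥-elim (¬b (f a))
  𝟙-cong (no ¬a) (yes b) f g = ⊥-elim (¬a (g b))
  𝟙-cong (no _) (no _) f g = refl

  𝟙-× : (d : Dec A) (d₁ : Dec B) (d₂ : Dec C) → (A → B) → (A → C) → (B → C → A) →
    𝟙 d ≡ 𝟙 d₁ * 𝟙 d₂
  𝟙-× (yes a) (yes _) (yes _) f g h = refl
  𝟙-× (yes a) (no ¬b) _ f g h = ⊥-elim (¬b (f a))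
  𝟙-× (yes a) (yes _) (no ¬c) f g h = ⊥-elim (¬c (g a))
  𝟙-× (no ¬a) (yes b) (yes c) f g h = ⊥-elim (¬a (h b c))
  𝟙-× (no _) (yes _) (no _) f g h = refl
  𝟙-× (no _) (no _) _ f g h = refl

open Indicator

module FinSum where
  open import Data.Integer using (_+_; _*_; _≤_)

  sum-const : ∀ n (x : ℤ) → ∑[ _ < n ] x ≡ + n * x
  sum-const zero x = refl
  sum-const (suc n) x = trans (cong (_+_ x) (sum-const n x)) (collect x (+ n))
    where collect : ∀ x n → x + n * x ≡ (1ℤ + n) * x
          collect = solve-∀

  sum-mono-≤ : ∀ {n} {f g : Fin n → ℤ} → (∀ i → f i ≤ g i) → sum f ≤ sum g
  sum-mono-≤ {zero} f≤g = ℤP.≤-refl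
  sum-mono-≤ {suc n} f≤g = ℤP.+-mono-≤ (f≤g zero) (sum-mono-≤ (f≤g ∘ suc))

  sum-δ : ∀ {n} (j : Fin n) (f : Fin n → ℤ) → ∑[ i < n ] (𝟙 (i FinP.≟ j) * f i) ≡ f j
  sum-δ {suc n} zero f = begin
      1ℤ * f zero + ∑[ i < n ] (0ℤ * f (suc i))
    ≡⟨ cong₂ _+_ (ℤP.*-identityˡ (f zero)) (sum-cong-≗ (λ i → ℤP.*-zeroˡ (f (suc i)))) ⟩
      f zero + ∑[ i < n ] 0ℤ
    ≡⟨ cong (_+_ (f zero)) (trans (sum-const n 0ℤ) (ℤP.*-zeroʳ (+ n))) ⟩
      f zero + 0ℤ
    ≡⟨ ℤP.+-identityʳ (f zero) ⟩
      f zero ∎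
    where open ≡-Reasoning
  sum-δ {suc n} (suc j) f = trans (ℤP.+-identityˡ _)
    (trans (sum-cong-≗ (λ i → cong (_* f (suc i)) (𝟙-cong (suc {n} i FinP.≟ suc j) (i FinP.≟ j) FinP.suc-injective (cong suc))))
           (sum-δ j (f ∘ suc)))

  sum-square : ∀ {n} (f : Fin n → ℤ) → sum f * sum f ≡ ∑[ i < n ] ∑[ j < n ] (f i * f j)
  sum-square {n} f = trans (*-distribʳ-sum {n} (sum f) f)
    (sum-cong-≗ {n} (λ i → *-distribˡ-sum {n} (f i) f))

open FinSum

module IntegerFacts where
  open import Data.Integer using (_+_; _*_; _-_; -_; _≤_)

  0≤n*[n+1] : ∀ n → 0ℤ ≤ n * (n + 1ℤ)
  0≤n*[n+1] (+ n) = subst (0ℤ ≤_) (ℤP.pos-* n (n ℕ.+ 1)) (ℤ.+≤+ ℕ.z≤n)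
  0≤n*[n+1] ℤ.-[1+ n ] = subst (0ℤ ≤_) (reflect ℤ.-[1+ n ]) (0≤n*[n+1] (+ n))
    where reflect : ∀ k → (- k - 1ℤ) * (- k - 1ℤ + 1ℤ) ≡ k * (k + 1ℤ)
          reflect = solve-∀

  0≤[dk]*[dk+d] : ∀ d k → 0ℤ ≤ (+ d * k) * (+ d * k + + d)
  0≤[dk]*[dk+d] d k = subst (0ℤ ≤_) (trans (cong (_* (k * (k + 1ℤ))) (ℤP.pos-* d d)) (factor (+ d) k))
    (subst (_≤ + (d ℕ.* d) * (k * (k + 1ℤ))) (ℤP.*-zeroʳ (+ (d ℕ.* d)))
      (ℤP.*-monoˡ-≤-nonNeg (+ (d ℕ.* d)) (0≤n*[n+1] k)))
    where factor : ∀ d k → d * d * (k * (k + 1ℤ)) ≡ (d * k) * (d * k + d)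
          factor = solve-∀

  *-cancelˡ-pred : ∀ q → 2 ℕ.≤ q → ∀ x y → (+ q - 1ℤ) * x ≡ (+ q - 1ℤ) * y → x ≡ y
  *-cancelˡ-pred (suc zero) (ℕ.s≤s ())
  *-cancelˡ-pred (suc (suc q)) _ x y = ℤP.*-cancelˡ-≡ (+ suc q) x y

  pow-gap : ∀ q s′ d → suc s′ ℕ.≤ d →
    + (q ℕ.^ d) - + (q ℕ.^ (d ℕ.∸ 1)) ≡ (+ q - 1ℤ) * (+ (q ℕ.^ s′) * + (q ℕ.^ (d ℕ.∸ suc s′)))
  pow-gap q s′ d s≤d = subst (λ d → + (q ℕ.^ d) - + (q ℕ.^ (d ℕ.∸ 1)) ≡ (+ q - 1ℤ) * (+ (q ℕ.^ s′) * + (q ℕ.^ (d ℕ.∸ suc s′))))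
    (ℕP.m+[n∸m]≡n s≤d) (gap (d ℕ.∸ suc s′))
    where
      gap : ∀ k → + (q ℕ.^ suc (s′ ℕ.+ k)) - + (q ℕ.^ (s′ ℕ.+ k)) ≡ (+ q - 1ℤ) * (+ (q ℕ.^ s′) * + (q ℕ.^ (suc s′ ℕ.+ k ℕ.∸ suc s′)))
      gap k = begin
          + (q ℕ.* q ℕ.^ (s′ ℕ.+ k)) - + (q ℕ.^ (s′ ℕ.+ k))
        ≡⟨ cong (_- + (q ℕ.^ (s′ ℕ.+ k))) (ℤP.pos-* q (q ℕ.^ (s′ ℕ.+ k))) ⟩
          + q * + (q ℕ.^ (s′ ℕ.+ k)) - + (q ℕ.^ (s′ ℕ.+ k))
        ≡⟨ factor (+ q) (+ (q ℕ.^ (s′ ℕ.+ k))) ⟩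
          (+ q - 1ℤ) * + (q ℕ.^ (s′ ℕ.+ k))
        ≡⟨ cong (λ e → (+ q - 1ℤ) * e) (trans (cong +_ (ℕP.^-distribˡ-+-* q s′ k)) (ℤP.pos-* (q ℕ.^ s′) (q ℕ.^ k))) ⟩
          (+ q - 1ℤ) * (+ (q ℕ.^ s′) * + (q ℕ.^ k))
        ≡⟨ cong (λ e → (+ q - 1ℤ) * (+ (q ℕ.^ s′) * + (q ℕ.^ e))) (ℕP.m+n∸m≡n s′ k) ⟨
          (+ q - 1ℤ) * (+ (q ℕ.^ s′) * + (q ℕ.^ (s′ ℕ.+ k ℕ.∸ s′))) ∎
        where
          open ≡-Reasoning
          factor : ∀ q x → q * x - x ≡ (q - 1ℤ) * x
          factor = solve-∀

open IntegerFacts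

module VectorSum (q : ℕ) where
  open import Data.Integer using (_+_; _*_; _-_; _≤_)

  private variable m n : ℕ

  _≟ᵛ_ : (x y : Vec (Fin q) n) → Dec (x ≡ y)
  _≟ᵛ_ = VecP.≡-dec FinP._≟_

  sumᵛ : ∀ n → (Vec (Fin q) n → ℤ) → ℤ
  sumᵛ zero f = f []
  sumᵛ (suc n) f = ∑[ a < q ] sumᵛ n (f ∘ (a ∷_))

  sumᵛ-cong : {f g : Vec (Fin q) n → ℤ} → (∀ x → f x ≡ g x) → sumᵛ n f ≡ sumᵛ n g
  sumᵛ-cong {zero} f≗g = f≗g []
  sumᵛ-cong {suc n} f≗g = sum-cong-≗ {q} (λ a → sumᵛ-cong (f≗g ∘ (a ∷_)))

  sumᵛ-distrib-+ : (f g : Vec (Fin q) n → ℤ) → sumᵛ n (λ x → f x + g x) ≡ sumᵛ n f + sumᵛ n g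
  sumᵛ-distrib-+ {zero} f g = refl
  sumᵛ-distrib-+ {suc n} f g =
    trans (sum-cong-≗ {q} (λ a → sumᵛ-distrib-+ {n} (f ∘ (a ∷_)) (g ∘ (a ∷_)))) (∑-distrib-+ {q} _ _)

  *-distribˡ-sumᵛ : (c : ℤ) (f : Vec (Fin q) n → ℤ) → sumᵛ n (λ x → c * f x) ≡ c * sumᵛ n f
  *-distribˡ-sumᵛ {zero} c f = refl
  *-distribˡ-sumᵛ {suc n} c f =
    trans (sum-cong-≗ {q} (λ a → *-distribˡ-sumᵛ {n} c (f ∘ (a ∷_)))) (sym (*-distribˡ-sum {q} c _))

  sumᵛ-distrib-- : (f g : Vec (Fin q) n → ℤ) → sumᵛ n (λ x → f x - g x) ≡ sumᵛ n f - sumᵛ n g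
  sumᵛ-distrib-- {n} f g = begin
      sumᵛ n (λ x → f x - g x)
    ≡⟨ sumᵛ-cong (λ x → minus-as-+ (f x) (g x)) ⟩
      sumᵛ n (λ x → f x + ℤ.-1ℤ * g x)
    ≡⟨ trans (sumᵛ-distrib-+ {n} f _) (cong (_+_ (sumᵛ n f)) (*-distribˡ-sumᵛ {n} ℤ.-1ℤ g)) ⟩
      sumᵛ n f + ℤ.-1ℤ * sumᵛ n g
    ≡⟨ minus-as-+ (sumᵛ n f) (sumᵛ n g) ⟨
      sumᵛ n f - sumᵛ n g ∎
    where
      open ≡-Reasoning
      minus-as-+ : ∀ a b → a - b ≡ a + ℤ.-1ℤ * b
      minus-as-+ = solve-∀

  sumᵛ-const : (c : ℤ) → sumᵛ n (λ _ → c) ≡ + (q ℕ.^ n) * c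
  sumᵛ-const {zero} c = sym (ℤP.*-identityˡ c)
  sumᵛ-const {suc n} c = begin
      ∑[ _ < q ] sumᵛ n (λ _ → c)
    ≡⟨ sum-cong-≗ {q} (λ _ → sumᵛ-const {n} c) ⟩
      ∑[ _ < q ] (+ (q ℕ.^ n) * c)
    ≡⟨ sum-const q _ ⟩
      + q * (+ (q ℕ.^ n) * c)
    ≡⟨ ℤP.*-assoc (+ q) _ c ⟨
      + q * + (q ℕ.^ n) * c
    ≡⟨ cong (_* c) (ℤP.pos-* q (q ℕ.^ n)) ⟨
      + (q ℕ.^ suc n) * c ∎
    where open ≡-Reasoning

  sumᵛ-comm-sum : ∀ {k} (f : Vec (Fin q) n → Fin k → ℤ) →
    sumᵛ n (λ x → ∑[ j < k ] f x j) ≡ ∑[ j < k ] sumᵛ n (λ x → f x j)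
  sumᵛ-comm-sum {zero} f = refl
  sumᵛ-comm-sum {suc n} f =
    trans (sum-cong-≗ {q} (λ a → sumᵛ-comm-sum {n} (f ∘ (a ∷_)))) (∑-comm {q} (λ a j → sumᵛ n (λ xs → f (a ∷ xs) j)))

  sumᵛ-comm : (f : Vec (Fin q) n → Vec (Fin q) m → ℤ) →
    sumᵛ n (λ x → sumᵛ m (f x)) ≡ sumᵛ m (λ y → sumᵛ n (λ x → f x y))
  sumᵛ-comm {zero} f = refl
  sumᵛ-comm {suc n} {m} f =
    trans (sum-cong-≗ {q} (λ a → sumᵛ-comm {n} (f ∘ (a ∷_))))
          (sym (sumᵛ-comm-sum {m} (λ y a → sumᵛ n (λ xs → f (a ∷ xs) y))))

  sumᵛ-mono-≤ : {f g : Vec (Fin q) n → ℤ} → (∀ x → f x ≤ g x) → sumᵛ n f ≤ sumᵛ n g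
  sumᵛ-mono-≤ {zero} f≤g = f≤g []
  sumᵛ-mono-≤ {suc n} f≤g = sum-mono-≤ {q} (λ a → sumᵛ-mono-≤ {n} (f≤g ∘ (a ∷_)))

  sumᵛ-δ : (y : Vec (Fin q) n) (f : Vec (Fin q) n → ℤ) → sumᵛ n (λ x → 𝟙 (x ≟ᵛ y) * f x) ≡ f y
  sumᵛ-δ {zero} [] f = ℤP.*-identityˡ (f [])
  sumᵛ-δ {suc n} (b ∷ y) f = trans (sum-cong-≗ at) (sum-δ b (λ a → f (a ∷ y)))
    where
      δ-∷ : ∀ a xs → 𝟙 ((a ∷ xs) ≟ᵛ (b ∷ y)) ≡ 𝟙 (a FinP.≟ b) * 𝟙 (xs ≟ᵛ y)
      δ-∷ a xs = 𝟙-× ((a ∷ xs) ≟ᵛ (b ∷ y)) (a FinP.≟ b) (xs ≟ᵛ y)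
        VecP.∷-injectiveˡ VecP.∷-injectiveʳ (cong₂ _∷_)
      at : ∀ a → sumᵛ n (λ xs → 𝟙 ((a ∷ xs) ≟ᵛ (b ∷ y)) * f (a ∷ xs)) ≡ 𝟙 (a FinP.≟ b) * f (a ∷ y)
      at a = begin
          sumᵛ n (λ xs → 𝟙 ((a ∷ xs) ≟ᵛ (b ∷ y)) * f (a ∷ xs))
        ≡⟨ sumᵛ-cong (λ xs → trans (cong (_* f (a ∷ xs)) (δ-∷ a xs)) (ℤP.*-assoc (𝟙 (a FinP.≟ b)) _ _)) ⟩
          sumᵛ n (λ xs → 𝟙 (a FinP.≟ b) * (𝟙 (xs ≟ᵛ y) * f (a ∷ xs)))
        ≡⟨ *-distribˡ-sumᵛ {n} (𝟙 (a FinP.≟ b)) _ ⟩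
          𝟙 (a FinP.≟ b) * sumᵛ n (λ xs → 𝟙 (xs ≟ᵛ y) * f (a ∷ xs))
        ≡⟨ cong (𝟙 (a FinP.≟ b) *_) (sumᵛ-δ y (f ∘ (a ∷_))) ⟩
          𝟙 (a FinP.≟ b) * f (a ∷ y) ∎
        where open ≡-Reasoning

  term≤sumᵛ : {f : Vec (Fin q) n → ℤ} → (∀ x → 0ℤ ≤ f x) → ∀ y → f y ≤ sumᵛ n f
  term≤sumᵛ {n} {f} f≥0 y =
    subst (_≤ sumᵛ n f) (sumᵛ-δ y f) (sumᵛ-mono-≤ (λ x → 𝟙*≤ (x ≟ᵛ y) (f≥0 x)))
    where
      𝟙*≤ : ∀ {A : Set} (d : Dec A) {z} → 0ℤ ≤ z → 𝟙 d * z ≤ z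
      𝟙*≤ (yes _) {z} _ = ℤP.≤-reflexive (ℤP.*-identityˡ z)
      𝟙*≤ (no _) z≥0 = z≥0

  sumᵛ-reindex : (σ σ⁻¹ : Vec (Fin q) n → Vec (Fin q) n) → (∀ x y → σ x ≡ y ⇔ x ≡ σ⁻¹ y) →
    (f : Vec (Fin q) n → ℤ) → sumᵛ n (f ∘ σ) ≡ sumᵛ n f
  sumᵛ-reindex {n} σ σ⁻¹ inverse f = begin
      sumᵛ n (f ∘ σ)
    ≡⟨ sumᵛ-cong (λ x → sym (sumᵛ-δ (σ x) f)) ⟩
      sumᵛ n (λ x → sumᵛ n (λ y → 𝟙 (y ≟ᵛ σ x) * f y))
    ≡⟨ sumᵛ-comm {n} {n} _ ⟩
      sumᵛ n (λ y → sumᵛ n (λ x → 𝟙 (y ≟ᵛ σ x) * f y))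
    ≡⟨ sumᵛ-cong (λ y → sumᵛ-cong (λ x → cong (_* f y) (𝟙-cong (y ≟ᵛ σ x) (x ≟ᵛ σ⁻¹ y)
         (Equivalence.to (inverse x y) ∘ sym) (sym ∘ Equivalence.from (inverse x y))))) ⟩
      sumᵛ n (λ y → sumᵛ n (λ x → 𝟙 (x ≟ᵛ σ⁻¹ y) * f y))
    ≡⟨ sumᵛ-cong (λ y → sumᵛ-δ (σ⁻¹ y) (λ _ → f y)) ⟩
      sumᵛ n f ∎
    where open ≡-Reasoning

module LinearAlgebra {q : ℕ} (K : FiniteField q) where
  open FiniteField K
  open VectorSum q

  commutativeRing : CommutativeRing _ _
  commutativeRing = record { isCommutativeRing = isCommutativeRing }

  module R = IsCommutativeRing isCommutativeRing
  module RP = RingProperties (CommutativeRing.ring commutativeRing)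
  module CS = CommutativeSemigroupProperties (CommutativeRing.+-commutativeSemigroup commutativeRing)

  private variable n : ℕ

  F : Set
  F = Fin q

  0ᵛ : Vec F n
  0ᵛ {n} = replicate n 0#

  infixl 6 _+ᵛ_
  infixl 7 _·ᵛ_ _∙_

  _+ᵛ_ : Vec F n → Vec F n → Vec F n
  _+ᵛ_ = zipWith _+_

  _·ᵛ_ : F → Vec F n → Vec F n
  t ·ᵛ x = map (t *_) x

  _∙_ : Vec F n → Vec F n → F
  [] ∙ [] = 0#
  (a ∷ x) ∙ (b ∷ y) = a * b + x ∙ y

  isZero : F → ℤ
  isZero t = 𝟙 (t FinP.≟ 0#)

  isNonzero : F → ℤ
  isNonzero t = 1ℤ ℤ.- isZero t

  isNonzeroᵛ : Vec F n → ℤ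
  isNonzeroᵛ x = 1ℤ ℤ.- 𝟙 (x ≟ᵛ 0ᵛ)

  isNonzero-0# : isNonzero 0# ≡ 0ℤ
  isNonzero-0# = cong (ℤ._-_ 1ℤ) (𝟙-yes (0# FinP.≟ 0#) refl)

  isNonzeroᵛ-0ᵛ : isNonzeroᵛ (0ᵛ {n}) ≡ 0ℤ
  isNonzeroᵛ-0ᵛ {n} = cong (ℤ._-_ 1ℤ) (𝟙-yes (0ᵛ {n} ≟ᵛ 0ᵛ) refl)

  isNonzeroᵛ-≢0ᵛ : (x : Vec F n) → x ≢ 0ᵛ → isNonzeroᵛ x ≡ 1ℤ
  isNonzeroᵛ-≢0ᵛ x x≢0 = cong (ℤ._-_ 1ℤ) (𝟙-no (x ≟ᵛ 0ᵛ) x≢0)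

  -‿*-assoc : ∀ a b → (- a) * b ≡ - (a * b)
  -‿*-assoc a b = sym (RP.-‿distribˡ-* a b)

  +-‿cancelʳ : ∀ a b → a + b + - b ≡ a
  +-‿cancelʳ a b = trans (R.+-assoc a b (- b)) (trans (cong (_+_ a) (R.-‿inverseʳ b)) (R.+-identityʳ a))

  -‿+-cancelʳ : ∀ a b → a + - b + b ≡ a
  -‿+-cancelʳ a b = trans (R.+-assoc a (- b) b) (trans (cong (_+_ a) (R.-‿inverseˡ b)) (R.+-identityʳ a))

  ∙-zeroˡ : (w : Vec F n) → 0ᵛ ∙ w ≡ 0#
  ∙-zeroˡ [] = refl
  ∙-zeroˡ (b ∷ w) = trans (cong₂ _+_ (R.zeroˡ b) (∙-zeroˡ w)) (R.+-identityʳ 0#)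

  ∙-zeroʳ : (w : Vec F n) → w ∙ 0ᵛ ≡ 0#
  ∙-zeroʳ [] = refl
  ∙-zeroʳ (b ∷ w) = trans (cong₂ _+_ (R.zeroʳ b) (∙-zeroʳ w)) (R.+-identityʳ 0#)

  ∙-comm : (x y : Vec F n) → x ∙ y ≡ y ∙ x
  ∙-comm [] [] = refl
  ∙-comm (a ∷ x) (b ∷ y) = cong₂ _+_ (R.*-comm a b) (∙-comm x y)

  ∙-distribʳ-+ᵛ : (x y w : Vec F n) → (x +ᵛ y) ∙ w ≡ x ∙ w + y ∙ w
  ∙-distribʳ-+ᵛ [] [] [] = sym (R.+-identityʳ 0#)
  ∙-distribʳ-+ᵛ (a ∷ x) (b ∷ y) (c ∷ w) = trans (cong (_+_ ((a + b) * c)) (∙-distribʳ-+ᵛ x y w))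
    (trans (cong (_+ (x ∙ w + y ∙ w)) (R.distribʳ c a b)) (CS.interchange (a * c) (b * c) (x ∙ w) (y ∙ w)))

  ∙-distribˡ-+ᵛ : (w x y : Vec F n) → w ∙ (x +ᵛ y) ≡ w ∙ x + w ∙ y
  ∙-distribˡ-+ᵛ w x y =
    trans (∙-comm w (x +ᵛ y)) (trans (∙-distribʳ-+ᵛ x y w) (cong₂ _+_ (∙-comm x w) (∙-comm y w)))

  ·ᵛ-∙-assoc : (t : F) (x w : Vec F n) → (t ·ᵛ x) ∙ w ≡ t * (x ∙ w)
  ·ᵛ-∙-assoc t [] [] = sym (R.zeroʳ t)
  ·ᵛ-∙-assoc t (a ∷ x) (c ∷ w) = trans (cong₂ _+_ (R.*-assoc t a c) (·ᵛ-∙-assoc t x w))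
    (sym (R.distribˡ t (a * c) (x ∙ w)))

  ∙-·ᵛ-comm : (t : F) (w x : Vec F n) → w ∙ (t ·ᵛ x) ≡ t * (w ∙ x)
  ∙-·ᵛ-comm t w x = trans (∙-comm w (t ·ᵛ x)) (trans (·ᵛ-∙-assoc t x w) (cong (t *_) (∙-comm x w)))

  ·ᵛ-identityˡ : (x : Vec F n) → 1# ·ᵛ x ≡ x
  ·ᵛ-identityˡ [] = refl
  ·ᵛ-identityˡ (a ∷ x) = cong₂ _∷_ (R.*-identityˡ a) (·ᵛ-identityˡ x)

  dual-vector : (w : Vec F n) → w ≢ 0ᵛ → ∃ λ z → z ∙ w ≡ 1#
  dual-vector [] w≢0 = ⊥-elim (w≢0 refl)
  dual-vector (a ∷ w) aw≢0 with a FinP.≟ 0#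
  ... | yes refl =
    let z , z∙w≡1 = dual-vector w (aw≢0 ∘ cong (0# ∷_))
    in 0# ∷ z , trans (cong₂ _+_ (R.zeroˡ 0#) z∙w≡1) (R.+-identityˡ 1#)
  ... | no a≢0 =
    let a⁻¹ , aa⁻¹≡1 = inverse a a≢0
    in a⁻¹ ∷ 0ᵛ , trans (cong₂ _+_ (trans (R.*-comm a⁻¹ a) aa⁻¹≡1) (∙-zeroˡ w)) (R.+-identityʳ 1#)

  y-p·ᵛx≡0ᵛ⇒y≡p·ᵛx : (p : F) (x y : Vec F n) → y +ᵛ (- p) ·ᵛ x ≡ 0ᵛ → y ≡ p ·ᵛ x
  y-p·ᵛx≡0ᵛ⇒y≡p·ᵛx p [] [] _ = refl
  y-p·ᵛx≡0ᵛ⇒y≡p·ᵛx p (a ∷ x) (b ∷ y) eq = cong₂ _∷_ head≡ (y-p·ᵛx≡0ᵛ⇒y≡p·ᵛx p x y (VecP.∷-injectiveʳ eq))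
    where
      head≡ : b ≡ p * a
      head≡ = begin
          b                       ≡⟨ -‿+-cancelʳ b (p * a) ⟨
          b + - (p * a) + p * a   ≡⟨ cong (λ t → b + t + p * a) (-‿*-assoc p a) ⟨
          b + (- p) * a + p * a   ≡⟨ cong (_+ p * a) (VecP.∷-injectiveˡ eq) ⟩
          0# + p * a              ≡⟨ R.+-identityˡ (p * a) ⟩
          p * a                   ∎
        where open ≡-Reasoning

  separating-vector : (x y : Vec F n) → x ≢ 0ᵛ → (∀ p → y ≢ p ·ᵛ x) →
    ∃ λ z → z ∙ x ≡ 0# × z ∙ y ≡ 1#
  -- z₂ is dual to y - (z₁ ∙ y) x; subtracting (z₂ ∙ x) z₁ makes it vanish on x.
  separating-vector x y x≢0 y∉⟨x⟩ =
    let z₁ , z₁∙x≡1 = dual-vector x x≢0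
        p = z₁ ∙ y
        z₂ , z₂∙y′≡1 = dual-vector (y +ᵛ (- p) ·ᵛ x) (y∉⟨x⟩ p ∘ y-p·ᵛx≡0ᵛ⇒y≡p·ᵛx p x y)
        r = z₂ ∙ x
        open ≡-Reasoning
    in z₂ +ᵛ (- r) ·ᵛ z₁ ,
      (begin
         (z₂ +ᵛ (- r) ·ᵛ z₁) ∙ x    ≡⟨ ∙-distribʳ-+ᵛ z₂ _ x ⟩
         r + ((- r) ·ᵛ z₁) ∙ x      ≡⟨ cong (_+_ r) (·ᵛ-∙-assoc (- r) z₁ x) ⟩
         r + (- r) * (z₁ ∙ x)       ≡⟨ cong (λ t → r + (- r) * t) z₁∙x≡1 ⟩
         r + (- r) * 1#             ≡⟨ cong (_+_ r) (R.*-identityʳ (- r)) ⟩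
         r + - r                    ≡⟨ R.-‿inverseʳ r ⟩
         0#                         ∎) ,
      (begin
         (z₂ +ᵛ (- r) ·ᵛ z₁) ∙ y    ≡⟨ ∙-distribʳ-+ᵛ z₂ _ y ⟩
         z₂ ∙ y + ((- r) ·ᵛ z₁) ∙ y ≡⟨ cong (_+_ (z₂ ∙ y)) (·ᵛ-∙-assoc (- r) z₁ y) ⟩
         z₂ ∙ y + (- r) * p         ≡⟨ cong (_+_ (z₂ ∙ y)) (trans (-‿*-assoc r p) (trans (cong -_ (R.*-comm r p)) (sym (-‿*-assoc p r)))) ⟩
         z₂ ∙ y + (- p) * r         ≡⟨ cong (_+_ (z₂ ∙ y)) (∙-·ᵛ-comm (- p) z₂ x) ⟨
         z₂ ∙ y + z₂ ∙ ((- p) ·ᵛ x) ≡⟨ ∙-distribˡ-+ᵛ z₂ y _ ⟨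
         z₂ ∙ (y +ᵛ (- p) ·ᵛ x)     ≡⟨ z₂∙y′≡1 ⟩
         1#                         ∎)

  sumᵛ-translate : (c : F) (z : Vec F n) (f : Vec F n → ℤ) → sumᵛ n (λ x → f (x +ᵛ c ·ᵛ z)) ≡ sumᵛ n f
  sumᵛ-translate c z = sumᵛ-reindex (λ x → x +ᵛ c ·ᵛ z) (λ y → y +ᵛ (- c) ·ᵛ z) λ x y →
    mk⇔ (λ eq → trans (sym (undo-translate c x)) (cong (λ t → t +ᵛ (- c) ·ᵛ z) eq))
        (λ eq → trans (cong (λ t → t +ᵛ c ·ᵛ z) eq) (redo-translate c y))
    where
      undo-translate : ∀ {n} c (x : Vec F n) {w : Vec F n} → x +ᵛ c ·ᵛ w +ᵛ (- c) ·ᵛ w ≡ x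
      undo-translate c [] {[]} = refl
      undo-translate c (b ∷ x) {a ∷ w} = cong₂ _∷_
        (trans (cong (_+_ (b + c * a)) (-‿*-assoc c a)) (+-‿cancelʳ b (c * a))) (undo-translate c x)
      redo-translate : ∀ {n} c (x : Vec F n) {w : Vec F n} → x +ᵛ (- c) ·ᵛ w +ᵛ c ·ᵛ w ≡ x
      redo-translate c [] {[]} = refl
      redo-translate c (b ∷ x) {a ∷ w} = cong₂ _∷_
        (trans (cong (λ t → b + t + c * a) (-‿*-assoc c a)) (-‿+-cancelʳ b (c * a))) (redo-translate c x)

  2≤q : 2 ℕ.≤ q
  2≤q = distinct⇒2≤ 0≢1
    where distinct⇒2≤ : ∀ {k} {a b : Fin k} → a ≢ b → 2 ℕ.≤ k
          distinct⇒2≤ {suc zero} {zero} {zero} a≢b = ⊥-elim (a≢b refl)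
          distinct⇒2≤ {suc (suc k)} _ = ℕ.s≤s (ℕ.s≤s ℕ.z≤n)

  q≢0 : ℕ.NonZero q
  q≢0 = ℕ.>-nonZero (ℕP.<-≤-trans (ℕ.s≤s ℕ.z≤n) 2≤q)

  isZero-+-cancelʳ : ∀ t c → 𝟙 ((t + c) FinP.≟ c) ≡ isZero t
  isZero-+-cancelʳ t c = 𝟙-cong ((t + c) FinP.≟ c) (t FinP.≟ 0#)
    (λ eq → trans (sym (+-‿cancelʳ t c)) (trans (cong (_+ - c) eq) (R.-‿inverseʳ c)))
    (λ eq → trans (cong (_+ c) eq) (R.+-identityˡ c))

  sum-𝟙-≟ : (t : F) → ∑[ c < q ] 𝟙 (t FinP.≟ c) ≡ 1ℤ
  sum-𝟙-≟ t = trans (sum-cong-≗ {q} (λ c → trans (𝟙-cong (t FinP.≟ c) (c FinP.≟ t) sym sym) (sym (ℤP.*-identityʳ _))))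
                    (sum-δ t (λ _ → 1ℤ))

  -- Translation by c·z carries the fibre of ℓ over 0 onto the fibre over c without changing g,
  -- so the q fibres all have the g-weight of the fibre over 0.
  q*sum-fibre₀ : (ℓ : Vec F n → F) (g : Vec F n → ℤ) (z : Vec F n) →
    (∀ c u → ℓ (u +ᵛ c ·ᵛ z) ≡ ℓ u + c) → (∀ c u → g (u +ᵛ c ·ᵛ z) ≡ g u) →
    + q ℤ.* sumᵛ n (λ u → g u ℤ.* isZero (ℓ u)) ≡ sumᵛ n g
  q*sum-fibre₀ {n} ℓ g z ℓ-shift g-invariant = begin
      + q ℤ.* fibre 0#
    ≡⟨ sum-const q (fibre 0#) ⟨
      ∑[ c < q ] fibre 0#
    ≡⟨ sum-cong-≗ {q} fibre-const ⟨
      ∑[ c < q ] fibre c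
    ≡⟨ sumᵛ-comm-sum {n} (λ u c → g u ℤ.* 𝟙 (ℓ u FinP.≟ c)) ⟨
      sumᵛ n (λ u → ∑[ c < q ] (g u ℤ.* 𝟙 (ℓ u FinP.≟ c)))
    ≡⟨ sumᵛ-cong (λ u → trans (sym (*-distribˡ-sum {q} (g u) _)) (trans (cong (g u ℤ.*_) (sum-𝟙-≟ (ℓ u))) (ℤP.*-identityʳ (g u)))) ⟩
      sumᵛ n g ∎
    where
      open ≡-Reasoning
      fibre : F → ℤ
      fibre c = sumᵛ n (λ u → g u ℤ.* 𝟙 (ℓ u FinP.≟ c))
      fibre-const : ∀ c → fibre c ≡ fibre 0#
      fibre-const c = trans (sym (sumᵛ-translate c z _)) (sumᵛ-cong λ u →
        cong₂ ℤ._*_ (g-invariant c u) (trans (cong (λ t → 𝟙 (t FinP.≟ c)) (ℓ-shift c u)) (isZero-+-cancelʳ (ℓ u) c)))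

  ∙-shift : (w z : Vec F n) → z ∙ w ≡ 1# → ∀ c u → (u +ᵛ c ·ᵛ z) ∙ w ≡ u ∙ w + c
  ∙-shift w z z∙w≡1 c u = trans (∙-distribʳ-+ᵛ u (c ·ᵛ z) w)
    (cong (_+_ (u ∙ w)) (trans (·ᵛ-∙-assoc c z w) (trans (cong (c *_) z∙w≡1) (R.*-identityʳ c))))

  ∙-invariant : (w z : Vec F n) → z ∙ w ≡ 0# → ∀ c u → (u +ᵛ c ·ᵛ z) ∙ w ≡ u ∙ w
  ∙-invariant w z z∙w≡0 c u = trans (∙-distribʳ-+ᵛ u (c ·ᵛ z) w)
    (trans (cong (_+_ (u ∙ w)) (trans (·ᵛ-∙-assoc c z w) (trans (cong (c *_) z∙w≡0) (R.zeroʳ c)))) (R.+-identityʳ (u ∙ w)))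

  count-orthogonal : ∀ d (w : Vec F (suc d)) → w ≢ 0ᵛ → sumᵛ (suc d) (λ u → isZero (u ∙ w)) ≡ + (q ℕ.^ d)
  count-orthogonal d w w≢0 = ℤP.*-cancelˡ-≡ (+ q) _ _ {{q≢0}} (begin
      + q ℤ.* sumᵛ (suc d) (λ u → isZero (u ∙ w))
    ≡⟨ cong (+ q ℤ.*_) (sumᵛ-cong {suc d} (λ u → sym (ℤP.*-identityˡ (isZero (u ∙ w))))) ⟩
      + q ℤ.* sumᵛ (suc d) (λ u → 1ℤ ℤ.* isZero (u ∙ w))
    ≡⟨ q*sum-fibre₀ (_∙ w) (λ _ → 1ℤ) z (∙-shift w z z∙w≡1) (λ _ _ → refl) ⟩
      sumᵛ (suc d) (λ _ → 1ℤ)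
    ≡⟨ trans (sumᵛ-const {suc d} 1ℤ) (ℤP.*-identityʳ (+ (q ℕ.^ suc d))) ⟩
      + (q ℕ.^ suc d)
    ≡⟨ ℤP.pos-* q (q ℕ.^ d) ⟩
      + q ℤ.* + (q ℕ.^ d) ∎)
    where
      open ≡-Reasoning
      z = proj₁ (dual-vector w w≢0)
      z∙w≡1 = proj₂ (dual-vector w w≢0)

  count-orthogonal₂ : ∀ d (x y : Vec F (suc (suc d))) → x ≢ 0ᵛ → (∀ p → y ≢ p ·ᵛ x) →
    sumᵛ (suc (suc d)) (λ u → isZero (u ∙ x) ℤ.* isZero (u ∙ y)) ≡ + (q ℕ.^ d)
  count-orthogonal₂ d x y x≢0 y∉⟨x⟩ with separating-vector x y x≢0 y∉⟨x⟩
  ... | z , z∙x≡0 , z∙y≡1 = ℤP.*-cancelˡ-≡ (+ q) _ _ {{q≢0}} (begin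
      + q ℤ.* sumᵛ (suc (suc d)) (λ u → isZero (u ∙ x) ℤ.* isZero (u ∙ y))
    ≡⟨ q*sum-fibre₀ (_∙ y) (λ u → isZero (u ∙ x)) z (∙-shift y z z∙y≡1) (λ c u → cong isZero (∙-invariant x z z∙x≡0 c u)) ⟩
      sumᵛ (suc (suc d)) (λ u → isZero (u ∙ x))
    ≡⟨ count-orthogonal (suc d) x x≢0 ⟩
      + (q ℕ.^ suc d)
    ≡⟨ ℤP.pos-* q (q ℕ.^ d) ⟩
      + q ℤ.* + (q ℕ.^ d) ∎)
    where open ≡-Reasoning

  count-nonorthogonal : ∀ d (w : Vec F d) →
    sumᵛ d (λ u → isNonzero (u ∙ w)) ≡ isNonzeroᵛ w ℤ.* (+ (q ℕ.^ d) ℤ.- + (q ℕ.^ (d ℕ.∸ 1)))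
  count-nonorthogonal zero [] = trans isNonzero-0# (sym (ℤP.*-zeroʳ (isNonzeroᵛ [])))
  count-nonorthogonal (suc d) w with w ≟ᵛ 0ᵛ
  ... | yes refl = begin
      sumᵛ (suc d) (λ u → isNonzero (u ∙ 0ᵛ))
    ≡⟨ sumᵛ-cong {suc d} (λ u → trans (cong isNonzero (∙-zeroʳ u)) isNonzero-0#) ⟩
      sumᵛ (suc d) (λ _ → 0ℤ)
    ≡⟨ trans (sumᵛ-const {suc d} 0ℤ) (ℤP.*-zeroʳ (+ (q ℕ.^ suc d))) ⟩
      0ℤ
    ≡⟨ ℤP.*-zeroˡ (+ (q ℕ.^ suc d) ℤ.- + (q ℕ.^ d)) ⟨
      0ℤ ℤ.* (+ (q ℕ.^ suc d) ℤ.- + (q ℕ.^ d)) ∎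
    where open ≡-Reasoning
  ... | no w≢0 = begin
      sumᵛ (suc d) (λ u → 1ℤ ℤ.- isZero (u ∙ w))
    ≡⟨ sumᵛ-distrib-- {suc d} (λ _ → 1ℤ) (λ u → isZero (u ∙ w)) ⟩
      sumᵛ (suc d) (λ _ → 1ℤ) ℤ.- sumᵛ (suc d) (λ u → isZero (u ∙ w))
    ≡⟨ cong₂ ℤ._-_ (trans (sumᵛ-const {suc d} 1ℤ) (ℤP.*-identityʳ (+ (q ℕ.^ suc d)))) (count-orthogonal d w w≢0) ⟩
      + (q ℕ.^ suc d) ℤ.- + (q ℕ.^ d)
    ≡⟨ ℤP.*-identityˡ _ ⟨
      1ℤ ℤ.* (+ (q ℕ.^ suc d) ℤ.- + (q ℕ.^ d)) ∎
    where open ≡-Reasoning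

≗-lookup⇒≡ : ∀ {a} {A : Set a} {n} {x y : Vec A n} → (∀ i → lookup x i ≡ lookup y i) → x ≡ y
≗-lookup⇒≡ {x = x} {y} x≗y =
  trans (sym (VecP.tabulate∘lookup x)) (trans (VecP.tabulate-cong x≗y) (VecP.tabulate∘lookup y))

module Partition {q : ℕ} (K : FiniteField q) {v : ℕ} (P : VSP K v) where
  open FiniteField K
  open LinearAlgebra K
  open VectorSum q
  open VSP P

  sumF-cong : ∀ {d} {f g : Fin d → F} → (∀ k → f k ≡ g k) → sumF K f ≡ sumF K g
  sumF-cong {zero} _ = refl
  sumF-cong {suc d} f≗g = cong₂ _+_ (f≗g zero) (sumF-cong (f≗g ∘ suc))

  sumF-distrib-- : ∀ {d} (f g : Fin d → F) → sumF K (λ k → f k + - g k) ≡ sumF K f + - sumF K g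
  sumF-distrib-- {zero} f g = sym (trans (cong (_+_ 0#) RP.-0#≈0#) (R.+-identityʳ 0#))
  sumF-distrib-- {suc d} f g = trans (cong (_+_ (f zero + - g zero)) (sumF-distrib-- (f ∘ suc) (g ∘ suc)))
    (trans (CS.interchange (f zero) (- g zero) _ _)
           (cong (_+_ (f zero + sumF K (f ∘ suc))) (RP.-‿+-comm (g zero) (sumF K (g ∘ suc)))))

  basisᵛ : (S : Subspace K v) → Fin (Subspace.dim S) → Vec F v
  basisᵛ S k = tabulate (Subspace.basis S k)

  combination : ∀ {d} → Vec F d → (Fin d → Vec F v) → Vec F v
  combination [] b = 0ᵛ
  combination (a ∷ as) b = a ·ᵛ b zero +ᵛ combination as (b ∘ suc)

  lookup-combination : ∀ {d} (a : Vec F d) (b : Fin d → Vec F v) (j : Fin v) →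
    lookup (combination a b) j ≡ sumF K (λ k → lookup a k * lookup (b k) j)
  lookup-combination [] b j = VecP.lookup-replicate j 0#
  lookup-combination (a ∷ as) b j = trans (VecP.lookup-zipWith _+_ j (a ·ᵛ b zero) (combination as (b ∘ suc)))
    (cong₂ _+_ (VecP.lookup-map j (a *_) (b zero)) (lookup-combination as (b ∘ suc) j))

  combination-∙ : ∀ {d} (a : Vec F d) (b : Fin d → Vec F v) (u : Vec F v) →
    combination a b ∙ u ≡ a ∙ tabulate (λ k → b k ∙ u)
  combination-∙ [] b u = ∙-zeroˡ u
  combination-∙ (a ∷ as) b u = trans (∙-distribʳ-+ᵛ (a ·ᵛ b zero) (combination as (b ∘ suc)) u)
    (cong₂ _+_ (·ᵛ-∙-assoc a (b zero) u) (combination-∙ as (b ∘ suc) u))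

  lookup-combination-basis : (S : Subspace K v) (a : Vec F (Subspace.dim S)) (j : Fin v) →
    lookup (combination a (basisᵛ S)) j ≡ sumF K (λ k → lookup a k * Subspace.basis S k j)
  lookup-combination-basis S a j = trans (lookup-combination a (basisᵛ S) j)
    (sumF-cong (λ k → cong (lookup a k *_) (VecP.lookup∘tabulate (Subspace.basis S k) j)))

  combination∈span : (S : Subspace K v) (a : Vec F (Subspace.dim S)) (x : Vec F v) →
    combination a (basisᵛ S) ≡ x → InSpan K (Subspace.basis S) (lookup x)
  combination∈span S a x refl = lookup a , lookup-combination-basis S a

  span⇒combination : (S : Subspace K v) (x : Vec F v) (x∈S : InSpan K (Subspace.basis S) (lookup x)) →
    combination (tabulate (proj₁ x∈S)) (basisᵛ S) ≡ x
  span⇒combination S x (α , x≡) = ≗-lookup⇒≡ λ j → trans (lookup-combination-basis S (tabulate α) j)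
    (trans (sumF-cong (λ k → cong (_* Subspace.basis S k j) (VecP.lookup∘tabulate α k))) (sym (x≡ j)))

  combination-injective : (S : Subspace K v) (a a′ : Vec F (Subspace.dim S)) →
    combination a (basisᵛ S) ≡ combination a′ (basisᵛ S) → a ≡ a′
  combination-injective S a a′ eq = ≗-lookup⇒≡ λ k →
    trans (sym (-‿+-cancelʳ (lookup a k) (lookup a′ k)))
      (trans (cong (_+ lookup a′ k) (Subspace.independent S (λ k → lookup a k + - lookup a′ k) difference≡0 k))
             (R.+-identityˡ (lookup a′ k)))
    where
      b = Subspace.basis S
      difference≡0 : ∀ j → sumF K (λ k → (lookup a k + - lookup a′ k) * b k j) ≡ 0#
      difference≡0 j = begin
          sumF K (λ k → (lookup a k + - lookup a′ k) * b k j)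
        ≡⟨ sumF-cong (λ k → trans (R.distribʳ (b k j) (lookup a k) (- lookup a′ k))
                                  (cong (_+_ (lookup a k * b k j)) (-‿*-assoc (lookup a′ k) (b k j)))) ⟩
          sumF K (λ k → lookup a k * b k j + - (lookup a′ k * b k j))
        ≡⟨ sumF-distrib-- (λ k → lookup a k * b k j) (λ k → lookup a′ k * b k j) ⟩
          sumF K (λ k → lookup a k * b k j) + - sumF K (λ k → lookup a′ k * b k j)
        ≡⟨ cong (_+ - sumF K (λ k → lookup a′ k * b k j))
             (trans (sym (lookup-combination-basis S a j))
               (trans (cong (λ x → lookup x j) eq) (lookup-combination-basis S a′ j))) ⟩
          sumF K (λ k → lookup a′ k * b k j) + - sumF K (λ k → lookup a′ k * b k j)
        ≡⟨ R.-‿inverseʳ _ ⟩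
          0# ∎
        where open ≡-Reasoning

  ≢0ᵛ⇒NonZeroVect : (x : Vec F v) → x ≢ 0ᵛ → NonZeroVect K (lookup x)
  ≢0ᵛ⇒NonZeroVect x x≢0 x≡0 = x≢0 (≗-lookup⇒≡ (λ j → trans (x≡0 j) (sym (VecP.lookup-replicate j 0#))))

  member-count : (x : Vec F v) → x ≢ 0ᵛ →
    ∑[ i < N ] sumᵛ (dimOf i) (λ a → 𝟙 (combination a (basisᵛ (member i)) ≟ᵛ x)) ≡ 1ℤ
  member-count x x≢0 with partition (lookup x) (≢0ᵛ⇒NonZeroVect x x≢0)
  ... | i₀ , x∈i₀ , unique = begin
      ∑[ i < N ] sumᵛ (dimOf i) (λ a → 𝟙 (combination a (basisᵛ (member i)) ≟ᵛ x))
    ≡⟨ sum-cong-≗ {N} (λ i → trans (in-member i) (sym (ℤP.*-identityʳ _))) ⟩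
      ∑[ i < N ] (𝟙 (i FinP.≟ i₀) ℤ.* 1ℤ)
    ≡⟨ sum-δ i₀ (λ _ → 1ℤ) ⟩
      1ℤ ∎
    where
      open ≡-Reasoning
      in-member : ∀ i → sumᵛ (dimOf i) (λ a → 𝟙 (combination a (basisᵛ (member i)) ≟ᵛ x)) ≡ 𝟙 (i FinP.≟ i₀)
      in-member i with i FinP.≟ i₀
      ... | yes refl = trans (sumᵛ-cong {dimOf i} (λ a → trans
              (𝟙-cong (combination a (basisᵛ (member i)) ≟ᵛ x) (a ≟ᵛ a₀)
                 (λ eq → combination-injective (member i) a a₀ (trans eq (sym (span⇒combination (member i) x x∈i₀))))
                 (λ { refl → span⇒combination (member i) x x∈i₀ }))
              (sym (ℤP.*-identityʳ _))))
            (sumᵛ-δ a₀ (λ _ → 1ℤ))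
        where a₀ = tabulate (proj₁ x∈i₀)
      ... | no i≢i₀ = trans (sumᵛ-cong {dimOf i} (λ a → 𝟙-no (combination a (basisᵛ (member i)) ≟ᵛ x)
              (i≢i₀ ∘ unique i ∘ combination∈span (member i) a x)))
            (trans (sumᵛ-const {dimOf i} 0ℤ) (ℤP.*-zeroʳ (+ (q ℕ.^ dimOf i))))

  restrict : (i : Fin N) → Vec F v → Vec F (dimOf i)
  restrict i u = tabulate (λ k → basisᵛ (member i) k ∙ u)

  restrict-0ᵛ : ∀ i → restrict i 0ᵛ ≡ 0ᵛ
  restrict-0ᵛ i = ≗-lookup⇒≡ λ k → trans (VecP.lookup∘tabulate _ k)
    (trans (∙-zeroʳ (basisᵛ (member i) k)) (sym (VecP.lookup-replicate k 0#)))

  -- Each nonzero x is a unique combination of the basis of a unique member.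
  count-nonorthogonal-by-members : (u : Vec F v) →
    sumᵛ v (λ x → isNonzero (x ∙ u)) ≡ ∑[ i < N ] sumᵛ (dimOf i) (λ a → isNonzero (a ∙ restrict i u))
  count-nonorthogonal-by-members u = begin
      sumᵛ v (λ x → isNonzero (x ∙ u))
    ≡⟨ sumᵛ-cong {v} split ⟩
      sumᵛ v (λ x → ∑[ i < N ] sumᵛ (dimOf i) (λ a → isNonzero (x ∙ u) ℤ.* δ i a x))
    ≡⟨ sumᵛ-comm-sum {v} {N} _ ⟩
      ∑[ i < N ] sumᵛ v (λ x → sumᵛ (dimOf i) (λ a → isNonzero (x ∙ u) ℤ.* δ i a x))
    ≡⟨ sum-cong-≗ {N} (λ i → sumᵛ-comm {v} {dimOf i} _) ⟩
      ∑[ i < N ] sumᵛ (dimOf i) (λ a → sumᵛ v (λ x → isNonzero (x ∙ u) ℤ.* δ i a x))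
    ≡⟨ sum-cong-≗ {N} (λ i → sumᵛ-cong {dimOf i} (λ a → pick i a)) ⟩
      ∑[ i < N ] sumᵛ (dimOf i) (λ a → isNonzero (combination a (basisᵛ (member i)) ∙ u))
    ≡⟨ sum-cong-≗ {N} (λ i → sumᵛ-cong {dimOf i} (λ a → cong isNonzero (combination-∙ a (basisᵛ (member i)) u))) ⟩
      ∑[ i < N ] sumᵛ (dimOf i) (λ a → isNonzero (a ∙ restrict i u)) ∎
    where
      open ≡-Reasoning
      δ : (i : Fin N) → Vec F (dimOf i) → Vec F v → ℤ
      δ i a x = 𝟙 (x ≟ᵛ combination a (basisᵛ (member i)))
      δ-sym : ∀ i a x → δ i a x ≡ 𝟙 (combination a (basisᵛ (member i)) ≟ᵛ x)
      δ-sym i a x = 𝟙-cong (x ≟ᵛ _) (_ ≟ᵛ x) sym sym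
      pick : ∀ i a → sumᵛ v (λ x → isNonzero (x ∙ u) ℤ.* δ i a x) ≡ isNonzero (combination a (basisᵛ (member i)) ∙ u)
      pick i a = trans (sumᵛ-cong {v} (λ x → ℤP.*-comm (isNonzero (x ∙ u)) (δ i a x)))
                       (sumᵛ-δ (combination a (basisᵛ (member i))) (λ x → isNonzero (x ∙ u)))
      covered : Vec F v → ℤ
      covered x = ∑[ i < N ] sumᵛ (dimOf i) (λ a → 𝟙 (combination a (basisᵛ (member i)) ≟ᵛ x))
      weight : ∀ x → isNonzero (x ∙ u) ≡ isNonzero (x ∙ u) ℤ.* covered x
      weight x with x ≟ᵛ 0ᵛ
      ... | yes refl = let 0∙u≡0 = trans (cong isNonzero (∙-zeroˡ u)) isNonzero-0#
                       in trans 0∙u≡0 (sym (trans (cong (ℤ._* covered 0ᵛ) 0∙u≡0) (ℤP.*-zeroˡ (covered 0ᵛ))))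
      ... | no x≢0 = sym (trans (cong (isNonzero (x ∙ u) ℤ.*_) (member-count x x≢0)) (ℤP.*-identityʳ _))
      split : ∀ x → isNonzero (x ∙ u) ≡ ∑[ i < N ] sumᵛ (dimOf i) (λ a → isNonzero (x ∙ u) ℤ.* δ i a x)
      split x = trans (weight x) (trans (*-distribˡ-sum {N} (isNonzero (x ∙ u)) _) (sum-cong-≗ {N} λ i →
        sym (trans (sumᵛ-cong {dimOf i} (λ a → cong (isNonzero (x ∙ u) ℤ.*_) (δ-sym i a x)))
                   (*-distribˡ-sumᵛ {dimOf i} (isNonzero (x ∙ u)) _))))

  record HoleVector (S : Subspace K v) : Set where
    field
      vector : Vec F v
      vector≢0ᵛ : vector ≢ 0ᵛ
      isNonzero-restrict : ∀ u → isNonzeroᵛ (tabulate (λ k → basisᵛ S k ∙ u)) ≡ isNonzero (u ∙ vector)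
      multiple∈span : ∀ p → InSpan K (Subspace.basis S) (lookup (p ·ᵛ vector))

  holeVector : (S : Subspace K v) → Subspace.dim S ≡ 1 → HoleVector S
  holeVector record { basis = basis ; independent = independent } refl = record
    { vector = b
    ; vector≢0ᵛ = b≢0ᵛ
    ; isNonzero-restrict = λ u → cong (ℤ._-_ 1ℤ) (𝟙-cong ((b ∙ u ∷ []) ≟ᵛ (0# ∷ [])) (u ∙ b FinP.≟ 0#)
        (trans (∙-comm u b) ∘ VecP.∷-injectiveˡ) (cong (_∷ []) ∘ trans (∙-comm b u)))
    ; multiple∈span = λ p → (λ _ → p) , λ j → trans (VecP.lookup-map j (p *_) b)
        (trans (cong (p *_) (VecP.lookup∘tabulate (basis zero) j)) (sym (R.+-identityʳ _)))
    }
    where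
      b = tabulate (basis zero)
      b≢0ᵛ : b ≢ 0ᵛ
      b≢0ᵛ b≡0 = 0≢1 (sym (independent (λ _ → 1#) b-coords≡0 zero))
        where
          b-coords≡0 : ∀ j → sumF K (λ k → 1# * basis k j) ≡ 0#
          b-coords≡0 j = trans (R.+-identityʳ _) (trans (R.*-identityˡ _)
            (trans (sym (VecP.lookup∘tabulate (basis zero) j)) (trans (cong (λ x → lookup x j) b≡0) (VecP.lookup-replicate j 0#))))

  hole-vectors-independent : (i j : Fin N) → i ≢ j → (Hi : HoleVector (member i)) (Hj : HoleVector (member j)) →
    ∀ p → HoleVector.vector Hj ≢ p ·ᵛ HoleVector.vector Hi
  hole-vectors-independent i j i≢j Hi Hj p bj≡pbi
    with partition (lookup (HoleVector.vector Hj)) (≢0ᵛ⇒NonZeroVect _ (HoleVector.vector≢0ᵛ Hj))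
  ... | _ , _ , unique = i≢j (trans
        (unique i (subst (InSpan K (Subspace.basis (member i)) ∘ lookup) (sym bj≡pbi) (HoleVector.multiple∈span Hi p)))
        (sym (unique j (subst (InSpan K (Subspace.basis (member j)) ∘ lookup) (·ᵛ-identityˡ (HoleVector.vector Hj)) (HoleVector.multiple∈span Hj 1#)))))

countOnes-sum : ∀ {q} (K : FiniteField q) {n} (f : Fin n → ℕ) → + countOnes K f ≡ ∑[ i < n ] 𝟙 (f i ℕ.≟ 1)
countOnes-sum K {zero} f = refl
countOnes-sum K {suc n} f with f zero ℕ.≟ 1
... | yes _ = cong (ℤ._+_ 1ℤ) (countOnes-sum K (f ∘ suc))
... | no _ = trans (countOnes-sum K (f ∘ suc)) (sym (ℤP.+-identityˡ _))

module HoleCount {q : ℕ} (K : FiniteField q) (v′ : ℕ) (P : VSP K (suc (suc v′))) where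
  open import Data.Integer using (_+_; _*_; _-_; _≤_)
  open LinearAlgebra K using (F; 0ᵛ; _·ᵛ_; _∙_; isZero; isNonzero; isNonzeroᵛ; isNonzeroᵛ-0ᵛ; isNonzeroᵛ-≢0ᵛ;
    2≤q; count-nonorthogonal; count-orthogonal; count-orthogonal₂)
  open VectorSum q
  open Partition K P
  open VSP P

  v : ℕ
  v = suc (suc v′)

  hole : Fin N → ℤ
  hole i = 𝟙 (dimOf i ℕ.≟ 1)

  notOrthogonal : Fin N → Vec F v → ℤ
  notOrthogonal i u = isNonzeroᵛ (restrict i u)

  holesOutside : Vec F v → ℤ
  holesOutside u = ∑[ i < N ] (hole i * notOrthogonal i u)

  #holes : ℤ
  #holes = sum hole

  A B : ℤ
  A = + (q ℕ.^ v) - + (q ℕ.^ suc v′)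
  B = A - (+ (q ℕ.^ suc v′) - + (q ℕ.^ v′))

  count-nonorthogonal₁ : (b : Vec F v) → b ≢ 0ᵛ → sumᵛ v (λ u → isNonzero (u ∙ b)) ≡ A
  count-nonorthogonal₁ b b≢0 = trans (count-nonorthogonal v b)
    (trans (cong (_* A) (isNonzeroᵛ-≢0ᵛ b b≢0)) (ℤP.*-identityˡ A))

  count-nonorthogonal₂ : (x y : Vec F v) → x ≢ 0ᵛ → y ≢ 0ᵛ → (∀ p → y ≢ p ·ᵛ x) →
    sumᵛ v (λ u → isNonzero (u ∙ x) * isNonzero (u ∙ y)) ≡ B
  count-nonorthogonal₂ x y x≢0 y≢0 y∉⟨x⟩ = begin
      sumᵛ v (λ u → isNonzero (u ∙ x) * isNonzero (u ∙ y))
    ≡⟨ sumᵛ-cong {v} (λ u → inclusion-exclusion (isZero (u ∙ x)) (isZero (u ∙ y))) ⟩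
      sumᵛ v (λ u → isNonzero (u ∙ x) - (isZero (u ∙ y) - isZero (u ∙ x) * isZero (u ∙ y)))
    ≡⟨ sumᵛ-distrib-- {v} (λ u → isNonzero (u ∙ x)) (λ u → isZero (u ∙ y) - isZero (u ∙ x) * isZero (u ∙ y)) ⟩
      sumᵛ v (λ u → isNonzero (u ∙ x)) - sumᵛ v (λ u → isZero (u ∙ y) - isZero (u ∙ x) * isZero (u ∙ y))
    ≡⟨ cong₂ _-_ (count-nonorthogonal₁ x x≢0)
         (trans (sumᵛ-distrib-- {v} (λ u → isZero (u ∙ y)) (λ u → isZero (u ∙ x) * isZero (u ∙ y)))
                (cong₂ _-_ (count-orthogonal (suc v′) y y≢0) (count-orthogonal₂ v′ x y x≢0 y∉⟨x⟩))) ⟩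
      B ∎
    where
      open ≡-Reasoning
      inclusion-exclusion : ∀ a b → (1ℤ - a) * (1ℤ - b) ≡ (1ℤ - a) - (b - a * b)
      inclusion-exclusion = solve-∀

  hole*sum-notOrthogonal : ∀ i → hole i * sumᵛ v (notOrthogonal i) ≡ hole i * A
  hole*sum-notOrthogonal i with dimOf i ℕ.≟ 1
  ... | no _ = refl
  ... | yes d≡1 = cong (1ℤ *_) (trans (sumᵛ-cong {v} isNonzero-restrict) (count-nonorthogonal₁ vector vector≢0ᵛ))
    where open HoleVector (holeVector (member i) d≡1)

  sum-holesOutside : sumᵛ v holesOutside ≡ #holes * A
  sum-holesOutside = begin
      sumᵛ v (λ u → ∑[ i < N ] (hole i * notOrthogonal i u))
    ≡⟨ sumᵛ-comm-sum {v} {N} (λ u i → hole i * notOrthogonal i u) ⟩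
      ∑[ i < N ] sumᵛ v (λ u → hole i * notOrthogonal i u)
    ≡⟨ sum-cong-≗ {N} (λ i → trans (*-distribˡ-sumᵛ {v} (hole i) (notOrthogonal i)) (hole*sum-notOrthogonal i)) ⟩
      ∑[ i < N ] (hole i * A)
    ≡⟨ *-distribʳ-sum {N} A hole ⟨
      #holes * A ∎
    where open ≡-Reasoning

  notOrthogonal-idem : ∀ i u → notOrthogonal i u * notOrthogonal i u ≡ notOrthogonal i u
  notOrthogonal-idem i u = idem (𝟙 (restrict i u ≟ᵛ 0ᵛ)) (𝟙-idem (restrict i u ≟ᵛ 0ᵛ))
    where
      idem : ∀ a → a * a ≡ a → (1ℤ - a) * (1ℤ - a) ≡ 1ℤ - a
      idem a a²≡a = trans (expand a) (trans (cong (λ t → 1ℤ - a - a + t) a²≡a) (collect a))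
        where expand : ∀ a → (1ℤ - a) * (1ℤ - a) ≡ 1ℤ - a - a + a * a
              expand = solve-∀
              collect : ∀ a → 1ℤ - a - a + a ≡ 1ℤ - a
              collect = solve-∀

  holes*sum-notOrthogonal² : ∀ i j → hole i * hole j * sumᵛ v (λ u → notOrthogonal i u * notOrthogonal j u)
                            ≡ hole i * hole j * (B + 𝟙 (j FinP.≟ i) * (A - B))
  holes*sum-notOrthogonal² i j with dimOf i ℕ.≟ 1 | dimOf j ℕ.≟ 1
  ... | no _ | _ = refl
  ... | yes _ | no _ = refl
  ... | yes dᵢ≡1 | yes dⱼ≡1 with i FinP.≟ j
  ...   | yes refl = cong (1ℤ * 1ℤ *_) (begin
      sumᵛ v (λ u → notOrthogonal i u * notOrthogonal i u)   ≡⟨ sumᵛ-cong {v} (notOrthogonal-idem i) ⟩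
      sumᵛ v (notOrthogonal i)                               ≡⟨ sumᵛ-cong {v} (HoleVector.isNonzero-restrict Hi) ⟩
      sumᵛ v (λ u → isNonzero (u ∙ bᵢ))                      ≡⟨ count-nonorthogonal₁ bᵢ (HoleVector.vector≢0ᵛ Hi) ⟩
      A                                                      ≡⟨ A≡ A B ⟩
      B + 1ℤ * (A - B)                                       ≡⟨ cong (λ t → B + t * (A - B)) (𝟙-yes (i FinP.≟ i) refl) ⟨
      B + 𝟙 (i FinP.≟ i) * (A - B)                           ∎)
    where
      open ≡-Reasoning
      Hi = holeVector (member i) dᵢ≡1
      bᵢ = HoleVector.vector Hi
      A≡ : ∀ A B → A ≡ B + 1ℤ * (A - B)
      A≡ = solve-∀
  ...   | no i≢j = cong (1ℤ * 1ℤ *_) (begin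
      sumᵛ v (λ u → notOrthogonal i u * notOrthogonal j u)
    ≡⟨ sumᵛ-cong {v} (λ u → cong₂ _*_ (HoleVector.isNonzero-restrict Hi u) (HoleVector.isNonzero-restrict Hj u)) ⟩
      sumᵛ v (λ u → isNonzero (u ∙ bᵢ) * isNonzero (u ∙ bⱼ))
    ≡⟨ count-nonorthogonal₂ bᵢ bⱼ (HoleVector.vector≢0ᵛ Hi) (HoleVector.vector≢0ᵛ Hj) (hole-vectors-independent i j i≢j Hi Hj) ⟩
      B
    ≡⟨ ℤP.+-identityʳ B ⟨
      B + 0ℤ
    ≡⟨ cong (_+_ B) (trans (cong (_* (A - B)) (𝟙-no (j FinP.≟ i) (i≢j ∘ sym))) (ℤP.*-zeroˡ (A - B))) ⟨
      B + 𝟙 (j FinP.≟ i) * (A - B) ∎)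
    where
      open ≡-Reasoning
      Hi = holeVector (member i) dᵢ≡1
      Hj = holeVector (member j) dⱼ≡1
      bᵢ = HoleVector.vector Hi
      bⱼ = HoleVector.vector Hj

  sum-holesOutside² : sumᵛ v (λ u → holesOutside u * holesOutside u) ≡ #holes * (#holes * B + (A - B))
  sum-holesOutside² = begin
      sumᵛ v (λ u → holesOutside u * holesOutside u)
    ≡⟨ sumᵛ-cong {v} (λ u → sum-square (f u)) ⟩
      sumᵛ v (λ u → ∑[ i < N ] ∑[ j < N ] (f u i * f u j))
    ≡⟨ sumᵛ-comm-sum {v} {N} (λ u i → ∑[ j < N ] (f u i * f u j)) ⟩
      ∑[ i < N ] sumᵛ v (λ u → ∑[ j < N ] (f u i * f u j))
    ≡⟨ sum-cong-≗ {N} (λ i → sumᵛ-comm-sum {v} {N} (λ u j → f u i * f u j)) ⟩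
      ∑[ i < N ] ∑[ j < N ] sumᵛ v (λ u → f u i * f u j)
    ≡⟨ sum-cong-≗ {N} (λ i → sum-cong-≗ {N} (λ j → trans
         (sumᵛ-cong {v} (λ u → interchange (hole i) (notOrthogonal i u) (hole j) (notOrthogonal j u)))
         (*-distribˡ-sumᵛ {v} (hole i * hole j) (λ u → notOrthogonal i u * notOrthogonal j u)))) ⟩
      ∑[ i < N ] ∑[ j < N ] (hole i * hole j * sumᵛ v (λ u → notOrthogonal i u * notOrthogonal j u))
    ≡⟨ sum-cong-≗ {N} (λ i → sum-cong-≗ {N} (λ j → trans (holes*sum-notOrthogonal² i j)
         (distribute (hole i) (hole j) B (𝟙 (j FinP.≟ i)) (A - B)))) ⟩
      ∑[ i < N ] ∑[ j < N ] (hole i * (hole j * B) + hole i * (A - B) * (𝟙 (j FinP.≟ i) * hole j))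
    ≡⟨ sum-cong-≗ {N} (λ i → trans (∑-distrib-+ {N} _ _) (cong₂ _+_
         (trans (sym (*-distribˡ-sum {N} (hole i) _)) (cong (hole i *_) (sym (*-distribʳ-sum {N} B hole))))
         (trans (sym (*-distribˡ-sum {N} (hole i * (A - B)) _)) (cong (hole i * (A - B) *_) (sum-δ i hole))))) ⟩
      ∑[ i < N ] (hole i * (#holes * B) + hole i * (A - B) * hole i)
    ≡⟨ sum-cong-≗ {N} (λ i → trans (square-hole (hole i) (#holes * B) (A - B))
         (cong (λ t → hole i * (#holes * B) + t * (A - B)) (𝟙-idem (dimOf i ℕ.≟ 1)))) ⟩
      ∑[ i < N ] (hole i * (#holes * B) + hole i * (A - B))
    ≡⟨ sum-cong-≗ {N} (λ i → sym (ℤP.*-distribˡ-+ (hole i) (#holes * B) (A - B))) ⟩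
      ∑[ i < N ] (hole i * (#holes * B + (A - B)))
    ≡⟨ *-distribʳ-sum {N} (#holes * B + (A - B)) hole ⟨
      #holes * (#holes * B + (A - B)) ∎
    where
      open ≡-Reasoning
      f : Vec F v → Fin N → ℤ
      f u i = hole i * notOrthogonal i u
      interchange : ∀ a b c d → (a * b) * (c * d) ≡ (a * c) * (b * d)
      interchange = solve-∀
      distribute : ∀ a b B d X → a * b * (B + d * X) ≡ a * (b * B) + a * X * (d * b)
      distribute = solve-∀
      square-hole : ∀ a Y X → a * Y + a * X * a ≡ a * Y + (a * a) * X
      square-hole = solve-∀

  module _ {t s′ c : ℕ} (H : HoleType K P t (suc s′) c) where
    open HoleType H

    Δ : ℤ
    Δ = + (q ℕ.^ s′)

    gap : ℕ → ℤ
    gap d = + (q ℕ.^ d) - + (q ℕ.^ (d ℕ.∸ 1))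

    nonHoleShare : Fin N → Vec F v → ℤ
    nonHoleShare i u = (1ℤ - hole i) * notOrthogonal i u * + (q ℕ.^ (dimOf i ℕ.∸ suc s′))

    notOrthogonal*gap : ∀ i u → notOrthogonal i u * gap (dimOf i) ≡ (+ q - 1ℤ) * (hole i * notOrthogonal i u + Δ * nonHoleShare i u)
    notOrthogonal*gap i u with dimOf i ℕ.≟ 1
    ... | no d≢1 = trans (cong (notOrthogonal i u *_) (pow-gap q s′ (dimOf i) (proj₁ (nonHoleDims i d≢1))))
                         (rearrange (notOrthogonal i u) (+ q) Δ _)
      where rearrange : ∀ n q Δ r → n * ((q - 1ℤ) * (Δ * r)) ≡ (q - 1ℤ) * (0ℤ * n + Δ * ((1ℤ - 0ℤ) * n * r))
            rearrange = solve-∀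
    ... | yes d≡1 = trans (cong (notOrthogonal i u *_) (trans (cong gap d≡1) (cong (λ x → + x - 1ℤ) (ℕP.*-identityʳ q))))
                          (rearrange (notOrthogonal i u) (+ q) Δ (+ (q ℕ.^ (dimOf i ℕ.∸ suc s′))))
      where rearrange : ∀ n q Δ r → n * (q - 1ℤ) ≡ (q - 1ℤ) * (1ℤ * n + Δ * ((1ℤ - 1ℤ) * n * r))
            rearrange = solve-∀

    holesOutside-0ᵛ : holesOutside 0ᵛ ≡ 0ℤ
    holesOutside-0ᵛ = trans (sum-cong-≗ {N} (λ i → trans (cong (λ x → hole i * isNonzeroᵛ x) (restrict-0ᵛ i))
                                         (trans (cong (hole i *_) (isNonzeroᵛ-0ᵛ {dimOf i})) (ℤP.*-zeroʳ (hole i)))))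
                            (trans (sum-const N 0ℤ) (ℤP.*-zeroʳ (+ N)))

    Δ∣holesOutside : ∀ u → ∃ λ a → holesOutside u ≡ Δ * a
    Δ∣holesOutside u with u ≟ᵛ 0ᵛ
    ... | yes refl = 0ℤ , trans holesOutside-0ᵛ (sym (ℤP.*-zeroʳ Δ))
    ... | no u≢0 = + (q ℕ.^ (v ℕ.∸ suc s′)) - R , solve-for-holes (*-cancelˡ-pred q 2≤q _ _ count)
      where
        R = ∑[ i < N ] nonHoleShare i u
        s≤v : suc s′ ℕ.≤ v
        s≤v = ℕP.≤-trans s≤t (ℕP.<⇒≤ t<v)
        count : (+ q - 1ℤ) * (Δ * + (q ℕ.^ (v ℕ.∸ suc s′))) ≡ (+ q - 1ℤ) * (holesOutside u + Δ * R)
        count = begin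
            (+ q - 1ℤ) * (Δ * + (q ℕ.^ (v ℕ.∸ suc s′)))
          ≡⟨ pow-gap q s′ v s≤v ⟨
            gap v
          ≡⟨ trans (cong (_* gap v) (isNonzeroᵛ-≢0ᵛ u u≢0)) (ℤP.*-identityˡ (gap v)) ⟨
            isNonzeroᵛ u * gap v
          ≡⟨ count-nonorthogonal v u ⟨
            sumᵛ v (λ x → isNonzero (x ∙ u))
          ≡⟨ count-nonorthogonal-by-members u ⟩
            ∑[ i < N ] sumᵛ (dimOf i) (λ a → isNonzero (a ∙ restrict i u))
          ≡⟨ sum-cong-≗ {N} (λ i → trans (count-nonorthogonal (dimOf i) (restrict i u)) (notOrthogonal*gap i u)) ⟩
            ∑[ i < N ] ((+ q - 1ℤ) * (hole i * notOrthogonal i u + Δ * nonHoleShare i u))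
          ≡⟨ *-distribˡ-sum {N} (+ q - 1ℤ) _ ⟨
            (+ q - 1ℤ) * ∑[ i < N ] (hole i * notOrthogonal i u + Δ * nonHoleShare i u)
          ≡⟨ cong ((+ q - 1ℤ) *_) (trans (∑-distrib-+ {N} _ _) (cong (_+_ (holesOutside u)) (sym (*-distribˡ-sum {N} Δ _)))) ⟩
            (+ q - 1ℤ) * (holesOutside u + Δ * R) ∎
          where open ≡-Reasoning
        solve-for-holes : Δ * + (q ℕ.^ (v ℕ.∸ suc s′)) ≡ holesOutside u + Δ * R →
          holesOutside u ≡ Δ * (+ (q ℕ.^ (v ℕ.∸ suc s′)) - R)
        solve-for-holes eq = trans (isolate (holesOutside u) Δ R) (trans (cong (_- Δ * R) (sym eq)) (factor Δ _ R))
          where isolate : ∀ h Δ R → h ≡ (h + Δ * R) - Δ * R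
                isolate = solve-∀
                factor : ∀ Δ Q R → Δ * Q - Δ * R ≡ Δ * (Q - R)
                factor = solve-∀

    #holes≡c : #holes ≡ + c
    #holes≡c = trans (sym (countOnes-sum K dimOf)) (cong +_ holes)

    module _ (m : ℤ) where
      g : Vec F v → ℤ
      g u = (holesOutside u - m * Δ) * (holesOutside u - m * Δ + Δ)

      0≤g : ∀ u → 0ℤ ≤ g u
      0≤g u with Δ∣holesOutside u
      ... | a , h≡Δa = subst (0ℤ ≤_) (sym (trans (cong (λ h → (h - m * Δ) * (h - m * Δ + Δ)) h≡Δa) (shift Δ a m)))
                              (0≤[dk]*[dk+d] (q ℕ.^ s′) (a - m))
        where shift : ∀ Δ a m → (Δ * a - m * Δ) * (Δ * a - m * Δ + Δ) ≡ (Δ * (a - m)) * (Δ * (a - m) + Δ)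
              shift = solve-∀

      sum-g : sumᵛ v g ≡ τ q c (q ℕ.^ s′) m * + (q ℕ.^ v′)
      sum-g = begin
          sumᵛ v g
        ≡⟨ sumᵛ-cong {v} (λ u → expand (holesOutside u) m Δ) ⟩
          sumᵛ v (λ u → holesOutside u * holesOutside u + (Δ - + 2 * m * Δ) * holesOutside u + m * Δ * (m * Δ - Δ))
        ≡⟨ trans (sumᵛ-distrib-+ {v} (λ u → square u + linear u) (λ _ → constant))
                 (cong (_+ sumᵛ v (λ _ → constant)) (sumᵛ-distrib-+ {v} square linear)) ⟩
          sumᵛ v (λ u → holesOutside u * holesOutside u) + sumᵛ v (λ u → (Δ - + 2 * m * Δ) * holesOutside u)
            + sumᵛ v (λ _ → m * Δ * (m * Δ - Δ))
        ≡⟨ cong₂ _+_ (cong₂ _+_ sum-holesOutside² (trans (*-distribˡ-sumᵛ {v} (Δ - + 2 * m * Δ) holesOutside) (cong ((Δ - + 2 * m * Δ) *_) sum-holesOutside)))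
                     (sumᵛ-const {v} constant) ⟩
          #holes * (#holes * B + (A - B)) + (Δ - + 2 * m * Δ) * (#holes * A) + + (q ℕ.^ v) * (m * Δ * (m * Δ - Δ))
        ≡⟨ collect #holes A B (+ (q ℕ.^ v)) #holes≡c A≡ B≡ q^v≡ ⟩
          τ q c (q ℕ.^ s′) m * Q ∎
        where
          open ≡-Reasoning
          Q = + (q ℕ.^ v′)
          square linear : Vec F v → ℤ
          square u = holesOutside u * holesOutside u
          linear u = (Δ - + 2 * m * Δ) * holesOutside u
          constant = m * Δ * (m * Δ - Δ)
          expand : ∀ h m Δ → (h - m * Δ) * (h - m * Δ + Δ) ≡ h * h + (Δ - + 2 * m * Δ) * h + m * Δ * (m * Δ - Δ)
          expand = solve-∀
          q^v′⁺¹≡ : + (q ℕ.^ suc v′) ≡ + q * Q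
          q^v′⁺¹≡ = ℤP.pos-* q (q ℕ.^ v′)
          q^v≡ : + (q ℕ.^ v) ≡ + q * (+ q * Q)
          q^v≡ = trans (ℤP.pos-* q (q ℕ.^ suc v′)) (cong (+ q *_) q^v′⁺¹≡)
          A≡ : A ≡ + q * (+ q * Q) - + q * Q
          A≡ = cong₂ _-_ q^v≡ q^v′⁺¹≡
          B≡ : B ≡ (+ q * (+ q * Q) - + q * Q) - (+ q * Q - Q)
          B≡ = cong₂ _-_ A≡ (cong (_- Q) q^v′⁺¹≡)
          τ-identity : ∀ q Q c Δ m →
            c * (c * (q * (q * Q) - q * Q - (q * Q - Q)) + (q * (q * Q) - q * Q - (q * (q * Q) - q * Q - (q * Q - Q))))
              + (Δ - + 2 * m * Δ) * (c * (q * (q * Q) - q * Q)) + q * (q * Q) * (m * Δ * (m * Δ - Δ))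
            ≡ (m * (m - 1ℤ) * Δ * Δ * q * q - c * (+ 2 * m - 1ℤ) * (q - 1ℤ) * Δ * q + c * (q - 1ℤ) * (c * (q - 1ℤ) + 1ℤ)) * Q
          τ-identity = solve-∀
          collect : ∀ C A B W → C ≡ + c → A ≡ + q * (+ q * Q) - + q * Q → B ≡ (+ q * (+ q * Q) - + q * Q) - (+ q * Q - Q) →
            W ≡ + q * (+ q * Q) →
            C * (C * B + (A - B)) + (Δ - + 2 * m * Δ) * (C * A) + W * (m * Δ * (m * Δ - Δ)) ≡ τ q c (q ℕ.^ s′) m * Q
          collect _ _ _ _ refl refl refl refl = τ-identity (+ q) Q (+ c) Δ m

    quadratic-bound : ∀ m → m * (m - 1ℤ) * Δ * Δ ≤ τ q c (q ℕ.^ s′) m * + (q ℕ.^ v′)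
    quadratic-bound m = subst₂ _≤_ g0≡ (sum-g m) (term≤sumᵛ {v} (0≤g m) 0ᵛ)
      where
        g0≡ : g m 0ᵛ ≡ m * (m - 1ℤ) * Δ * Δ
        g0≡ = trans (cong (λ h → (h - m * Δ) * (h - m * Δ + Δ)) holesOutside-0ᵛ) (expand m Δ)
          where expand : ∀ m Δ → (0ℤ - m * Δ) * (0ℤ - m * Δ + Δ) ≡ m * (m - 1ℤ) * Δ * Δ
                expand = solve-∀

module TauFacts where
  open import Data.Integer using (_+_; _*_; _-_; _≤_)

  private
    *-cancelʳ-≤-suc : ∀ {x y} n → 0 ℕ.< n → x * + n ≤ y * + n → x ≤ y
    *-cancelʳ-≤-suc {x} {y} (suc n) _ = ℤP.*-cancelʳ-≤-pos x y (+ suc n)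

    +[n∸1]≡+n-1 : ∀ n → 0 ℕ.< n → + (n ℕ.∸ 1) ≡ + n - 1ℤ
    +[n∸1]≡+n-1 (suc n) _ = refl

    c[q∸1]≢0 : ∀ c q → 0 ℕ.< c → 2 ℕ.≤ q → c ℕ.* (q ℕ.∸ 1) ≢ 0
    c[q∸1]≢0 (suc c) (suc zero) _ (ℕ.s≤s ())
    c[q∸1]≢0 (suc c) (suc (suc q)) _ _ ()

    1≤qΔ : ∀ q Δ → 0 ℕ.< q → 0 ℕ.< Δ → 1 ℕ.≤ q ℕ.* Δ
    1≤qΔ (suc q) (suc Δ) _ _ = ℕ.s≤s ℕ.z≤n

  0≤m[m-1]ΔΔ : ∀ Δ m → 0ℤ ≤ m * (m - 1ℤ) * + Δ * + Δ
  0≤m[m-1]ΔΔ Δ m = subst (0ℤ ≤_) (regroup (+ Δ) m) (0≤[dk]*[dk+d] Δ (m - 1ℤ))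
    where regroup : ∀ Δ m → (Δ * (m - 1ℤ)) * (Δ * (m - 1ℤ) + Δ) ≡ m * (m - 1ℤ) * Δ * Δ
          regroup = solve-∀

  m[m-1]≤0⇒m∈01 : ∀ m → m * (m - 1ℤ) ≤ 0ℤ → m ≡ 0ℤ ⊎ m ≡ 1ℤ
  m[m-1]≤0⇒m∈01 (+ 0) _ = inj₁ refl
  m[m-1]≤0⇒m∈01 (+ 1) _ = inj₂ refl
  m[m-1]≤0⇒m∈01 (+ suc (suc n)) (ℤ.+≤+ ())
  m[m-1]≤0⇒m∈01 ℤ.-[1+ n ] (ℤ.+≤+ ())

  module _ (q c Δ : ℕ) (0<q : 0 ℕ.< q) where
    private
      X≡ : + c * (+ q - 1ℤ) ≡ + (c ℕ.* (q ℕ.∸ 1))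
      X≡ = trans (cong (+ c *_) (sym (+[n∸1]≡+n-1 q 0<q))) (sym (ℤP.pos-* c (q ℕ.∸ 1)))

    τ-at-0 : τ q c Δ 0ℤ ≡ + (c ℕ.* (q ℕ.∸ 1)) * (1ℤ + (+ (q ℕ.* Δ) + + (c ℕ.* (q ℕ.∸ 1))))
    τ-at-0 = trans (factor (+ q) (+ c) (+ Δ)) (cong₂ (λ x qΔ → x * (1ℤ + (qΔ + x))) X≡ (sym (ℤP.pos-* q Δ)))
      where factor : ∀ q c Δ → 0ℤ * (0ℤ - 1ℤ) * Δ * Δ * q * q - c * (+ 2 * 0ℤ - 1ℤ) * (q - 1ℤ) * Δ * q
                                 + c * (q - 1ℤ) * (c * (q - 1ℤ) + 1ℤ)
                               ≡ (c * (q - 1ℤ)) * (1ℤ + (q * Δ + c * (q - 1ℤ)))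
            factor = solve-∀

    τ-at-1 : τ q c Δ 1ℤ ≡ + (c ℕ.* (q ℕ.∸ 1)) * (+ (c ℕ.* (q ℕ.∸ 1)) + 1ℤ - + (q ℕ.* Δ))
    τ-at-1 = trans (factor (+ q) (+ c) (+ Δ)) (cong₂ (λ x qΔ → x * (x + 1ℤ - qΔ)) X≡ (sym (ℤP.pos-* q Δ)))
      where factor : ∀ q c Δ → 1ℤ * (1ℤ - 1ℤ) * Δ * Δ * q * q - c * (+ 2 * 1ℤ - 1ℤ) * (q - 1ℤ) * Δ * q
                                 + c * (q - 1ℤ) * (c * (q - 1ℤ) + 1ℤ)
                               ≡ (c * (q - 1ℤ)) * (c * (q - 1ℤ) + 1ℤ - q * Δ)
            factor = solve-∀

  module _ (q c Δ Q : ℕ) (m : ℤ) (0<Q : 0 ℕ.< Q) (bound : m * (m - 1ℤ) * + Δ * + Δ ≤ τ q c Δ m * + Q) where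

    0≤τ : 0ℤ ≤ τ q c Δ m
    0≤τ = *-cancelʳ-≤-suc Q 0<Q (ℤP.≤-trans (0≤m[m-1]ΔΔ Δ m) bound)

    τ≡0⇔ : 2 ℕ.≤ q → 0 ℕ.< Δ → 0 ℕ.< c → τ q c Δ m ≡ 0ℤ ⇔ (m ≡ 1ℤ × c ℕ.* (q ℕ.∸ 1) ≡ q ℕ.* Δ ℕ.∸ 1)
    τ≡0⇔ 2≤q 0<Δ 0<c = mk⇔ (λ τ≡0 → only-if τ≡0 (m∈01 τ≡0)) if
      where
        X = c ℕ.* (q ℕ.∸ 1)
        0<q : 0 ℕ.< q
        0<q = ℕP.<-≤-trans (ℕ.s≤s ℕ.z≤n) 2≤q
        X≢0 : X ≢ 0
        X≢0 = c[q∸1]≢0 c q 0<c 2≤q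
        m∈01 : τ q c Δ m ≡ 0ℤ → m ≡ 0ℤ ⊎ m ≡ 1ℤ
        m∈01 τ≡0 = m[m-1]≤0⇒m∈01 m (*-cancelʳ-≤-suc Δ 0<Δ (*-cancelʳ-≤-suc Δ 0<Δ (subst (λ t → _ ≤ t * + Q) τ≡0 bound)))
        only-if : τ q c Δ m ≡ 0ℤ → m ≡ 0ℤ ⊎ m ≡ 1ℤ → m ≡ 1ℤ × X ≡ q ℕ.* Δ ℕ.∸ 1
        only-if τ≡0 (inj₁ refl) with ℤP.i*j≡0⇒i≡0∨j≡0 (+ X) (trans (sym (τ-at-0 q c Δ 0<q)) τ≡0)
        ... | inj₁ +X≡0 = ⊥-elim (X≢0 (ℤP.+-injective +X≡0))
        ... | inj₂ ()
        only-if τ≡0 (inj₂ refl) with ℤP.i*j≡0⇒i≡0∨j≡0 (+ X) (trans (sym (τ-at-1 q c Δ 0<q)) τ≡0)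
        ... | inj₁ +X≡0 = ⊥-elim (X≢0 (ℤP.+-injective +X≡0))
        ... | inj₂ X+1-qΔ≡0 = refl , trans (sym (ℕP.m+n∸n≡m X 1))
                (cong (ℕ._∸ 1) (ℤP.+-injective (ℤP.i-j≡0⇒i≡j (+ X + 1ℤ) (+ (q ℕ.* Δ)) X+1-qΔ≡0)))
        if : m ≡ 1ℤ × X ≡ q ℕ.* Δ ℕ.∸ 1 → τ q c Δ m ≡ 0ℤ
        if (refl , X≡qΔ-1) = begin
            τ q c Δ 1ℤ                             ≡⟨ τ-at-1 q c Δ 0<q ⟩
            + X * (+ X + 1ℤ - + (q ℕ.* Δ))         ≡⟨ cong (λ n → + X * (+ n - + (q ℕ.* Δ))) X+1≡qΔ ⟩
            + X * (+ (q ℕ.* Δ) - + (q ℕ.* Δ))      ≡⟨ cong (+ X *_) (ℤP.+-inverseʳ (+ (q ℕ.* Δ))) ⟩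
            + X * 0ℤ                               ≡⟨ ℤP.*-zeroʳ (+ X) ⟩
            0ℤ                                     ∎
          where
            open ≡-Reasoning
            X+1≡qΔ : X ℕ.+ 1 ≡ q ℕ.* Δ
            X+1≡qΔ = trans (cong (ℕ._+ 1) X≡qΔ-1) (ℕP.m∸n+n≡m (1≤qΔ q Δ 0<q 0<Δ))

open import Data.Nat using (ℕ; _<_; _∸_; _^_)
open import Data.Integer using (ℤ; +_; 0ℤ; 1ℤ; _-_; _*_; _≤_)
open import Data.Product using (_×_)
open import Relation.Binary.PropositionalEquality using (_≡_)
open import Function.Bundles using (_⇔_)
open TauFacts using (0≤τ; τ≡0⇔)

lemma10 : ∀ (q : ℕ) (K : FiniteField q) (v t s c : ℕ) (P : VSP K v) →
    HoleType K P t s c → ∀ (m : ℤ) →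
    (m * (m - 1ℤ) * (+ (q ^ (s ∸ 1))) * (+ (q ^ (s ∸ 1))) ≤ τ q c (q ^ (s ∸ 1)) m * (+ (q ^ (v ∸ 2))))
    × (0ℤ ≤ τ q c (q ^ (s ∸ 1)) m)
    × (0 < c → (τ q c (q ^ (s ∸ 1)) m ≡ 0ℤ) ⇔ ((m ≡ 1ℤ) × (c Data.Nat.* (q ∸ 1) ≡ q ^ s ∸ 1)))
lemma10 q K zero t s c P H m = ⊥-elim (ℕP.n≮0 (HoleType.t<v H))
lemma10 q K (suc zero) t s c P H m =
  ⊥-elim (ℕP.n≮0 (ℕP.≤-trans (HoleType.2≤s H) (ℕP.≤-trans (HoleType.s≤t H) (ℕP.≤-pred (HoleType.t<v H)))))
lemma10 q K (suc (suc v′)) t zero c P H m = ⊥-elim (ℕP.n≮0 (HoleType.2≤s H))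
lemma10 q K (suc (suc v′)) t (suc s′) c P H m =
  bound , 0≤τ q c (q ^ s′) (q ^ v′) m 0<q^v′ bound ,
  τ≡0⇔ q c (q ^ s′) (q ^ v′) m 0<q^v′ bound 2≤q (ℕP.m^n>0 q {{q≢0}} s′)
  where
    open LinearAlgebra K using (2≤q; q≢0)
    bound = HoleCount.quadratic-bound K v′ P H m
    0<q^v′ = ℕP.m^n>0 q {{q≢0}} v′
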